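{- Consider a star instance with center agent $n$, a leaf agent $1$, and a leaf agent $k\notin\{1,n\}$. If $o_1\succ_n o_k$, then $o_1$ is not reachable for agent $k$.
   Context: Agents $N=\{1,\dots,n\}$ form a star network with center $n$ and leaves $1,\dots,n-1$; objects $O=\{o_1,\dots,o_n\}$; each agent $i$ has a weak preference $\succeq_i$ (a complete preorder on $O$, ties allowed, strict part $\succ_i$); agent $i$ initially holds $o_i$. A swap exchanges the objects of two adjacent agents $i,j$ in an assignment $\sigma$ and is allowed only if $\sigma(j)\succeq_i\sigma(i)$ and $\sigma(i)\succeq_j\sigma(j)$. An object $o$ is reachable for agent $i$ if some sequence of allowed swaps from the initial assignment yields an assignment in which $i$ holds $o$. -}

module Defs where

open import Data.Nat using (ℕ; suc)
open import Data.Fin using (Fin; fromℕ)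
open import Data.Product using (_×_; Σ; ∃)
open import Data.Sum using (_⊎_)
open import Relation.Nullary using (¬_)
open import Relation.Binary.PropositionalEquality using (_≡_; _≢_)
open import Relation.Binary.Construct.Closure.ReflexiveTransitive using (Star)

-- Agents and objects are both indexed by Fin n; object o_i is represented by i.
-- Weak preferences: Pref n assigns to each agent i a relation  a ⪰ᵢ b.
Pref : ℕ → Set₁
Pref n = Fin n → Fin n → Fin n → Set

IsWeakOrderProfile : ∀ {n} → Pref n → Set
IsWeakOrderProfile {n} ⪰ =
  (∀ i a b → ⪰ i a b ⊎ ⪰ i b a) ×
  (∀ i a b c → ⪰ i a b → ⪰ i b c → ⪰ i a c)

Strict : ∀ {n} → Pref n → Fin n → Fin n → Fin n → Set
Strict ⪰ i a b = ⪰ i a b × ¬ ⪰ i b a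

center : (n : ℕ) → Fin (suc n)
center n = fromℕ n

StarAdj : (n : ℕ) → Fin (suc n) → Fin (suc n) → Set
StarAdj n i j = i ≢ j × (i ≡ center n ⊎ j ≡ center n)

Assignment : ℕ → Set
Assignment n = Fin n → Fin n

Swapped : ∀ {n} → Assignment n → Fin n → Fin n → Assignment n → Set
Swapped {n} σ i j σ' =
  σ' i ≡ σ j × σ' j ≡ σ i × (∀ l → l ≢ i → l ≢ j → σ' l ≡ σ l)

SwapStep : (n : ℕ) → Pref (suc n) → Assignment (suc n) → Assignment (suc n) → Set
SwapStep n ⪰ σ σ' =
  Σ (Fin (suc n)) λ i → Σ (Fin (suc n)) λ j →
    StarAdj n i j × ⪰ i (σ j) (σ i) × ⪰ j (σ i) (σ j) × Swapped σ i j σ'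

initial : ∀ {n} → Assignment n
initial a = a

Reachable : (n : ℕ) → Pref (suc n) → Fin (suc n) → Fin (suc n) → Set
Reachable n ⪰ i o =
  ∃ λ σ → Star (SwapStep n ⪰) initial σ × σ i ≡ o

module Submission where

open import Defs
open import Data.Nat using (ℕ; suc)
open import Data.Fin using (Fin; zero; _≟_)
open import Data.Product using (_,_; proj₁; proj₂)
open import Data.Sum using (inj₁; inj₂; reduce)
open import Relation.Nullary using (¬_; yes; no; contradiction)
open import Relation.Binary.PropositionalEquality using (_≢_; refl; sym; subst)
open import Relation.Binary.Construct.Closure.ReflexiveTransitive using (Star; fold)

-- A leaf only ever trades with the center, and the center accepts only objects it weakly
-- prefers, so in the center's eyes every leaf's object can only get worse along a swap
-- sequence. Agent k starts with o_k, which the center ranks strictly below o_1.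

module _ {n : ℕ} {⪰ : Pref (suc n)} (weakOrder : IsWeakOrderProfile ⪰) where

  private
    c : Fin (suc n)
    c = center n

  ⪰-refl : ∀ i a → ⪰ i a a
  ⪰-refl i a = reduce (proj₁ weakOrder i a a)

  ⪰-trans : ∀ i a b d → ⪰ i a b → ⪰ i b d → ⪰ i a d
  ⪰-trans = proj₂ weakOrder

  swapStep-leaf-descends : ∀ {k σ σ'} → k ≢ c → SwapStep n ⪰ σ σ' → ⪰ c (σ k) (σ' k)
  swapStep-leaf-descends {k} {σ} k≢c (i , j , (_ , adj) , ⪰ᵢ , ⪰ⱼ , σ'i , σ'j , σ'-rest)
    with k ≟ i | k ≟ j | adj
  ... | yes refl | _        | inj₁ k≡c = contradiction k≡c k≢c
  ... | yes refl | _        | inj₂ refl = subst (⪰ c (σ k)) (sym σ'i) ⪰ⱼ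
  ... | no _     | yes refl | inj₂ k≡c = contradiction k≡c k≢c
  ... | no _     | yes refl | inj₁ refl = subst (⪰ c (σ k)) (sym σ'j) ⪰ᵢ
  ... | no k≢i   | no k≢j   | _ = subst (⪰ c (σ k)) (sym (σ'-rest k k≢i k≢j)) (⪰-refl c (σ k))

  swaps-leaf-descends : ∀ {k σ σ'} → k ≢ c → Star (SwapStep n ⪰) σ σ' → ⪰ c (σ k) (σ' k)
  swaps-leaf-descends {k} k≢c =
    fold (λ σ σ' → ⪰ c (σ k) (σ' k))
      (λ step descends → ⪰-trans c _ _ _ (swapStep-leaf-descends k≢c step) descends)
      (⪰-refl c _)

lemma18 : (n : ℕ) (⪰ : Pref (suc n)) → IsWeakOrderProfile ⪰ →
    (k : Fin (suc n)) → k ≢ zero → k ≢ center n →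
    Strict ⪰ (center n) zero k →
    ¬ Reachable n ⪰ k zero
lemma18 n ⪰ weakOrder k _ k≢c (_ , ok⋡o₁) (σ , swaps , σk≡o₁) =
  ok⋡o₁ (subst (⪰ (center n) k) σk≡o₁ (swaps-leaf-descends weakOrder k≢c swaps))
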